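{- Let $(\Gamma,\tau)$ be a $z$-homogeneous triangulation of a connected closed surface, $P$ a special pair in $\Gamma$ with $z$-monodromy $M_P\in S_4$, and $k$ the number of zigzags from $\tau$ passing through the edges of $P$. Then: $k=1$ if $M_P\in K_i$ with $i\in\{1,3,7,8\}$; $k=2$ if $M_P\in K_i$ with $i\in\{0,4,5,11,12\}$; $k=3$ if $M_P\in K_i$ with $i\in\{6,9,10\}$; $k=4$ if $M_P\in K_2$. Here the classes are $K_0=\{\mathrm{id}\}$, $K_1=\{(1234)\}$, $K_2=\{(13)(24)\}$, $K_3=\{(1432)\}$, $K_4=\{(14)(23)\}$, $K_5=\{(12)(34)\}$, $K_6=\{(24),(13)\}$, $K_7=\{(34),(12)\}$, $K_8=\{(23),(14)\}$, $K_9=\{(1324),(1423)\}$, $K_{10}=\{(1243),(1342)\}$, $K_{11}=\{(234),(123),(124),(134)\}$, $K_{12}=\{(243),(132),(142),(143)\}$.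
   Context: Surfaces are connected closed 2-dimensional (not necessarily orientable). An embedded graph is a closed 2-cell embedding of a connected finite graph in a surface with no vertices of degree 2; a triangulation is such an embedding of a simple graph with all faces triangles. Two distinct edges are adjacent if they share a vertex and lie in a common face. A zigzag is a cyclic sequence of edges $\{e_i\}$ with $e_i,e_{i+1}$ adjacent, the faces containing $e_i,e_{i+1}$ and $e_{i+1},e_{i+2}$ distinct, and $e_i,e_{i+2}$ without common vertex; $Z^{ -1}$ denotes the reversed sequence. A $z$-orientation $\tau$ contains exactly one of $Z,Z^{ -1}$ for every zigzag $Z$. Each edge is traversed twice by zigzags of $\tau$: it is of type I if in opposite directions, of type II if in the same direction (then $\tau$ directs it). $(\Gamma,\tau)$ is $z$-homogeneous if every face has two edges of type I and one of type II, and every zigzag of $\tau$ is a cyclic sequence $\{e_i,e'_i,e''_i\}_{i=1}^n$ with $e_i$ of type II and $e'_i,e''_i$ of type I. A special pair $P$ is a directed path $e_1=v_1v_2$, $e_2=v_2v_3$ of two type II edges (directed by $\tau$). Let $F_i^\pm$ be the faces containing $e_i$, labelled so that $F_1^\delta,F_2^\delta$ are on the same side of $P$. Splitting $v_2$ into $v_2^\pm$ and $e_i$ into $e_i^\pm$ (directed as $e_i$, $e_1^\delta=v_1v_2^\delta$, $e_2^\delta=v_2^\delta v_3$, $e_i^\delta\subset F_i^\delta$) yields an embedded graph $N_P(\Gamma)$ with a new 4-gonal face $F_P$. For a face $F$ with consecutive vertices $x_1,\dots,x_k$ let $\Omega(F)$ be its $2k$ directed edges and $D_F$ the permutation of $\Omega(F)$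 sending $xx'$ to $x'x''$ for consecutive vertices $x,x',x''$ of $F$. The $z$-monodromy $M_F$ of $F$: for $e\in\Omega(F)$ take $e_0$ with $D_F(e_0)=e$ and the zigzag containing $e_0,e$ consecutively; $M_F(e)$ is the first element of $\Omega(F)$ occurring in this zigzag after $e$. The $z$-monodromy $M_P$ of $P$ is the restriction of $M_{F_P}$ (in $N_P(\Gamma)$) to $\{e_1^+,e_2^+,e_1^-,e_2^-\}$; it is a permutation of this set, identified with an element of $S_4$ by writing $1,2,3,4$ for $e_1^+,e_2^+,e_1^-,e_2^-$. -}

module Defs where

-- Embedded graphs on closed surfaces are encoded combinatorially as
-- "graph-encoded maps" (flag systems): a finite set of flags Fin n with
-- three fixed-point-free involutions σ₀ σ₁ σ₂ such that σ₀σ₂ = σ₂σ₀ is a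
-- fixed-point-free involution and the generated group is transitive.
-- A flag is an incident (vertex, edge, face) triple; σ₀ changes the vertex,
-- σ₁ the edge, σ₂ the face.  Vertices / edges / faces are the orbits of
-- ⟨σ₁,σ₂⟩ / ⟨σ₀,σ₂⟩ / ⟨σ₀,σ₁⟩.  Zigzags (Petrie walks) are orbits of
-- ρ = σ₁ ∘ σ₀ ∘ σ₂; a flag f in a zigzag means the zigzag traverses the edge
-- of f starting at the vertex of f and then turns, inside the face of
-- σ₀ (σ₂ f), at the other endpoint.  σ₁ maps a zigzag onto its reverse.

open import Data.Nat using (ℕ; zero; suc; _+_; _<_)
import Data.Fin
open import Data.Fin using (Fin; #_) renaming (_≟_ to _≟F_)
open import Data.Bool using (Bool; true; false; not; _xor_)
open import Data.Maybe using (Maybe; just; nothing)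
open import Data.Sum using (_⊎_; inj₁; inj₂)
open import Data.Product using (Σ; ∃; _×_; _,_)
open import Data.List using (List; []; _∷_; length)
open import Data.List.Relation.Unary.All using (All)
open import Data.List.Relation.Unary.Any using (Any)
open import Data.List.Relation.Unary.AllPairs using (AllPairs)
open import Data.Vec using (Vec; lookup) renaming ([] to []ᵛ; _∷_ to _∷ᵛ_)
open import Function using (_∘_)
open import Relation.Binary.PropositionalEquality using (_≡_; _≢_)
open import Relation.Binary.Construct.Closure.ReflexiveTransitive using (Star)
open import Relation.Nullary using (¬_; yes; no)

iter : {A : Set} → (A → A) → ℕ → A → A
iter f zero x = x
iter f (suc k) x = f (iter f k x)

record Map : Set where
  field
    n : ℕ
    σ₀ σ₁ σ₂ : Fin n → Fin n
    σ₀-inv : ∀ f → σ₀ (σ₀ f) ≡ f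
    σ₁-inv : ∀ f → σ₁ (σ₁ f) ≡ f
    σ₂-inv : ∀ f → σ₂ (σ₂ f) ≡ f
    σ₀-free : ∀ f → σ₀ f ≢ f
    σ₁-free : ∀ f → σ₁ f ≢ f
    σ₂-free : ∀ f → σ₂ f ≢ f
    σ₀σ₂-comm : ∀ f → σ₀ (σ₂ f) ≡ σ₂ (σ₀ f)
    σ₀σ₂-free : ∀ f → σ₀ (σ₂ f) ≢ f
    connected : ∀ f g → Star (λ x y → y ≡ σ₀ x ⊎ y ≡ σ₁ x ⊎ y ≡ σ₂ x) f g

module _ (M : Map) where
  open Map M

  SameVertex : Fin n → Fin n → Set
  SameVertex = Star (λ x y → y ≡ σ₁ x ⊎ y ≡ σ₂ x)

  SameEdge : Fin n → Fin n → Set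
  SameEdge = Star (λ x y → y ≡ σ₀ x ⊎ y ≡ σ₂ x)

  ρ : Fin n → Fin n
  ρ = σ₁ ∘ σ₀ ∘ σ₂

  SameZigzag : Fin n → Fin n → Set
  SameZigzag = Star (λ x y → y ≡ ρ x)

  -- Triangulation: simple graph, all faces triangles, no vertex of degree 2.
  -- (For a triangle face of a loopless graph the boundary is automatically
  -- a simple cycle, so the embedding is closed.)
  record Triangulation : Set where
    field
      no-loops : ∀ f → ¬ SameVertex f (σ₀ f)
      no-multi-edges : ∀ f g → SameVertex f g → SameVertex (σ₀ f) (σ₀ g) → SameEdge f g
      faces-triangles : ∀ f → iter (σ₁ ∘ σ₀) 3 f ≡ f
      faces-nontrivial : ∀ f → σ₁ (σ₀ f) ≢ f
      -- the rotation σ₂σ₁ at a vertex of degree d has order d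
      no-degree-2 : ∀ f → iter (σ₂ ∘ σ₁) 2 f ≡ f → σ₂ (σ₁ f) ≡ f

  -- z-orientation: S is the set of flags of the chosen directed zigzags;
  -- it is a union of ρ-orbits and contains exactly one of f, σ₁ f
  -- (i.e. exactly one of Z, Z⁻¹ for every zigzag Z).
  record ZOrientation : Set where
    field
      S : Fin n → Bool
      S-ρ : ∀ f → S (ρ f) ≡ S f
      S-σ₁ : ∀ f → S (σ₁ f) ≡ not (S f)

count3 : Bool → Bool → Bool → ℕ
count3 a b c = B a + B b + B c
  where
  B : Bool → ℕ
  B true = 1
  B false = 0

ExactlyOne : Bool → Bool → Bool → Set
ExactlyOne a b c = count3 a b c ≡ 1

module _ (M : Map) (τ : ZOrientation M) where
  open Map M
  open ZOrientation τ

  -- The two passages of the τ-zigzags through the edge of f correspond to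
  -- the two S-flags among the four flags of that edge.  They go in the same
  -- direction (type II) iff they lie at the same vertex, i.e. iff
  -- S f = S (σ₂ f).
  isII : Fin n → Bool
  isII f = not (S f xor S (σ₂ f))

  record ZHomogeneous : Set where
    field
      face-types : ∀ f → ExactlyOne (isII f) (isII (σ₁ f)) (isII (σ₁ (σ₀ f)))
      -- every zigzag of τ has the form {e_i, e'_i, e''_i} with e_i type II,
      -- e'_i, e''_i type I: every three consecutive edges contain exactly one
      -- edge of type II
      zigzag-types : ∀ f → S f ≡ true → ExactlyOne (isII f) (isII (ρ M f)) (isII (ρ M (ρ M f)))

  -- Special pair P = (e₁ = v₁v₂, e₂ = v₂v₃), both of type II, directed by τ.
  -- a is the flag (v₂, e₁, F₁⁺), b the flag (v₂, e₂, F₂⁺); the condition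
  -- `same-side` says that F₂⁺ is reached from F₁⁺ by rotating around v₂
  -- starting from a (crossing first σ₁), i.e. F₁⁺ and F₂⁺ are on the same
  -- side of P.  Both labellings (δ = ±) are covered by the choice of a.
  record SpecialPair : Set where
    field
      a b : Fin n
      -- S-flags of e₁ are σ₀ a and σ₂ (σ₀ a), both at v₁: e₁ is of type II, directed v₁ → v₂
      e₁-dir₁ : S (σ₀ a) ≡ true
      e₁-dir₂ : S (σ₂ (σ₀ a)) ≡ true
      -- S-flags of e₂ are b and σ₂ b, both at v₂: e₂ is of type II, directed v₂ → v₃
      e₂-dir₁ : S b ≡ true
      e₂-dir₂ : S (σ₂ b) ≡ true
      common-vertex : SameVertex M a b
      distinct-edges : ¬ SameEdge M a b
      same-side : ∃ λ j → b ≡ σ₁ (iter (σ₂ ∘ σ₁) j a)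

-- The embedded graph N_P(Γ): flags of Γ plus the 8 flags of the new face F_P.

data Sgn : Set where
  plus minus : Sgn

data Idx : Set where
  one two : Idx

data End : Set where
  tl hd : End   -- tail / head of the edge with respect to the τ-direction

flipS : Sgn → Sgn
flipS plus = minus
flipS minus = plus

flipE : End → End
flipE tl = hd
flipE hd = tl

-- (s , i , t) : the flag of F_P on the edge e_i^s at its endpoint t.
-- e₁^s = v₁ v₂^s,  e₂^s = v₂^s v₃;  F_P = v₁ v₂⁺ v₃ v₂⁻.
New : Set
New = Sgn × Idx × End

allNew : List New
allNew = (plus , one , tl) ∷ (plus , one , hd) ∷ (plus , two , tl) ∷ (plus , two , hd)
       ∷ (minus , one , tl) ∷ (minus , one , hd) ∷ (minus , two , tl) ∷ (minus , two , hd) ∷ []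

module NP (M : Map) (τ : ZOrientation M) (P : SpecialPair M τ) where
  open Map M
  open SpecialPair P

  NFlag : Set
  NFlag = Fin n ⊎ New

  -- old flag of Γ on the same edge and vertex as the new flag, in the face F_i^s
  old : New → Fin n
  old (plus , one , hd) = a
  old (plus , one , tl) = σ₀ a
  old (minus , one , hd) = σ₂ a
  old (minus , one , tl) = σ₀ (σ₂ a)
  old (plus , two , tl) = b
  old (plus , two , hd) = σ₀ b
  old (minus , two , tl) = σ₂ b
  old (minus , two , hd) = σ₀ (σ₂ b)

  σ₀N : NFlag → NFlag
  σ₀N (inj₁ x) = inj₁ (σ₀ x)
  σ₀N (inj₂ (s , i , t)) = inj₂ (s , i , flipE t)

  σ₁N : NFlag → NFlag
  σ₁N (inj₁ x) = inj₁ (σ₁ x)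
  σ₁N (inj₂ (s , one , tl)) = inj₂ (flipS s , one , tl)
  σ₁N (inj₂ (s , one , hd)) = inj₂ (s , two , tl)
  σ₁N (inj₂ (s , two , tl)) = inj₂ (s , one , hd)
  σ₁N (inj₂ (s , two , hd)) = inj₂ (flipS s , two , hd)

  matchOld : Fin n → List New → NFlag
  matchOld x [] = inj₁ (σ₂ x)
  matchOld x (ν ∷ νs) with x ≟F old ν
  ... | yes _ = inj₂ ν
  ... | no _ = matchOld x νs

  σ₂N : NFlag → NFlag
  σ₂N (inj₁ x) = matchOld x allNew
  σ₂N (inj₂ ν) = inj₁ (old ν)

  ρN : NFlag → NFlag
  ρN = σ₁N ∘ σ₀N ∘ σ₂N

  -- the directed edge of F_P (an element of Ω(F_P), represented by the new
  -- flag at its starting vertex) traversed by a zigzag at a given flag, if any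
  dirEdge : NFlag → Maybe New
  dirEdge (inj₂ ν) = just ν
  dirEdge (inj₁ x) with σ₂N (inj₁ x)
  ... | inj₂ ν = just ν
  ... | inj₁ _ = nothing

  -- The zigzag containing e₀, ν
  -- consecutively (D_{F_P}(e₀) = ν) is the ρN-orbit through the flag ν;
  -- μ is the first element of Ω(F_P) it traverses after ν.
  Mono : New → New → Set
  Mono ν μ = Σ ℕ λ j → (0 < j) × (dirEdge (iter ρN j (inj₂ ν)) ≡ just μ)
                     × (∀ i → 0 < i → i < j → dirEdge (iter ρN i (inj₂ ν)) ≡ nothing)

  -- 1, 2, 3, 4  =  e₁⁺, e₂⁺, e₁⁻, e₂⁻  (directed as e₁, e₂)
  label : Fin 4 → New
  label Fin.zero = (plus , one , tl)
  label (Fin.suc Fin.zero) = (plus , two , tl)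
  label (Fin.suc (Fin.suc Fin.zero)) = (minus , one , tl)
  label (Fin.suc (Fin.suc (Fin.suc Fin.zero))) = (minus , two , tl)

-- Permutations of {1,2,3,4}, given by the vector of images of 1,2,3,4
-- (0-indexed: # 0 = 1, ..., # 3 = 4).

Perm4 : Set
Perm4 = Vec (Fin 4) 4

perm : Fin 4 → Fin 4 → Fin 4 → Fin 4 → Perm4
perm w x y z = w ∷ᵛ x ∷ᵛ y ∷ᵛ z ∷ᵛ []ᵛ

MonodromyIs : (M : Map) (τ : ZOrientation M) (P : SpecialPair M τ) → Perm4 → Set
MonodromyIs M τ P π = ∀ c → NP.Mono M τ P (NP.label M τ P c) (NP.label M τ P (lookup π c))

d1 d2 d3 d4 : Fin 4
d1 = # 0
d2 = # 1
d3 = # 2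
d4 = # 3

K : Fin 13 → List Perm4
K Fin.zero = perm d1 d2 d3 d4 ∷ []                                   -- id
K (Fin.suc Fin.zero) = perm d2 d3 d4 d1 ∷ []                          -- (1234)
K (Fin.suc (Fin.suc Fin.zero)) = perm d3 d4 d1 d2 ∷ []                -- (13)(24)
K (Fin.suc (Fin.suc (Fin.suc Fin.zero))) = perm d4 d1 d2 d3 ∷ []      -- (1432)
K (Fin.suc (Fin.suc (Fin.suc (Fin.suc Fin.zero)))) = perm d4 d3 d2 d1 ∷ []   -- (14)(23)
K (Fin.suc (Fin.suc (Fin.suc (Fin.suc (Fin.suc Fin.zero))))) = perm d2 d1 d4 d3 ∷ []   -- (12)(34)
K (Fin.suc (Fin.suc (Fin.suc (Fin.suc (Fin.suc (Fin.suc Fin.zero)))))) =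
  perm d1 d4 d3 d2 ∷ perm d3 d2 d1 d4 ∷ []                            -- (24), (13)
K (Fin.suc (Fin.suc (Fin.suc (Fin.suc (Fin.suc (Fin.suc (Fin.suc Fin.zero))))))) =
  perm d1 d2 d4 d3 ∷ perm d2 d1 d3 d4 ∷ []                            -- (34), (12)
K (Fin.suc (Fin.suc (Fin.suc (Fin.suc (Fin.suc (Fin.suc (Fin.suc (Fin.suc Fin.zero)))))))) =
  perm d1 d3 d2 d4 ∷ perm d4 d2 d3 d1 ∷ []                            -- (23), (14)
K (Fin.suc (Fin.suc (Fin.suc (Fin.suc (Fin.suc (Fin.suc (Fin.suc (Fin.suc (Fin.suc Fin.zero))))))))) =
  perm d3 d4 d2 d1 ∷ perm d4 d3 d1 d2 ∷ []                            -- (1324), (1423)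
K (Fin.suc (Fin.suc (Fin.suc (Fin.suc (Fin.suc (Fin.suc (Fin.suc (Fin.suc (Fin.suc (Fin.suc Fin.zero)))))))))) =
  perm d2 d4 d1 d3 ∷ perm d3 d1 d4 d2 ∷ []                            -- (1243), (1342)
K (Fin.suc (Fin.suc (Fin.suc (Fin.suc (Fin.suc (Fin.suc (Fin.suc (Fin.suc (Fin.suc (Fin.suc (Fin.suc Fin.zero))))))))))) =
  perm d1 d3 d4 d2 ∷ perm d2 d3 d1 d4 ∷ perm d2 d4 d3 d1 ∷ perm d3 d2 d4 d1 ∷ []   -- (234), (123), (124), (134)
K (Fin.suc (Fin.suc (Fin.suc (Fin.suc (Fin.suc (Fin.suc (Fin.suc (Fin.suc (Fin.suc (Fin.suc (Fin.suc (Fin.suc Fin.zero)))))))))))) =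
  perm d1 d4 d2 d3 ∷ perm d3 d1 d2 d4 ∷ perm d4 d1 d3 d2 ∷ perm d4 d2 d1 d3 ∷ []   -- (243), (132), (142), (143)

kOf : Fin 13 → ℕ
kOf i = table (Data.Fin.toℕ i)
  where
  table : ℕ → ℕ
  table 0 = 2
  table 1 = 1
  table 2 = 4
  table 3 = 1
  table 4 = 2
  table 5 = 2
  table 6 = 3
  table 7 = 1
  table 8 = 1
  table 9 = 3
  table 10 = 3
  table 11 = 2
  table 12 = 2
  table _ = 0

NumClasses : {A : Set} → (A → A → Set) → List A → ℕ → Set
NumClasses {A} R xs k = Σ (List A) λ ys → (length ys ≡ k)
  × AllPairs (λ y y' → ¬ R y y') ys
  × All (λ y → Any (R y) xs) ys
  × All (λ x → Any (R x) ys) xs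

-- k = number of zigzags of τ through the edges of P: the ρ-orbits of the
-- S-flags on e₁ (σ₀ a, σ₂ (σ₀ a)) and on e₂ (b, σ₂ b)
ZigzagsThrough : (M : Map) (τ : ZOrientation M) (P : SpecialPair M τ) → ℕ → Set
ZigzagsThrough M τ P k =
  NumClasses (SameZigzag M) (σ₀ a ∷ σ₂ (σ₀ a) ∷ b ∷ σ₂ b ∷ []) k
  where open Map M
        open SpecialPair P

{-# OPTIONS --safe #-}
module Submission where

-- A zigzag of N_P(Γ) leaving the new face F_P through the flag of e_i^s
-- first crosses into Γ (in the face F_i^s), then runs along a τ-zigzag of Γ
-- until it re-enters F_P.  Hence the first-return map of the τ-zigzags of Γ
-- to the four flags at which they start traversing e₁ and e₂ is
-- M_P ∘ (13)(24): the factor (13)(24) accounts for the crossing of F_P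
-- from e_i^s to e_i^(-s).  The number k of zigzags through P is therefore
-- the number of cycles of M_P ∘ (13)(24), which is read off class by class.

open import Defs
open import Data.Fin using (Fin)
open import Data.List.Membership.Propositional using (_∈_)
open import Relation.Binary.PropositionalEquality using (_≡_)

open import Data.Nat using (ℕ; zero; suc; _+_; _∸_; _≤_; _<_; z≤n; s≤s)
open import Data.Nat.Properties
  using (n<1+n; m≤n⇒m<n∨m≡n; m∸n+n≡m; +-monoʳ-<; <⇒≤; ≤-refl)
  renaming (_≟_ to _≟ℕ_)
open import Data.Fin using (toℕ; fromℕ<) renaming (_≟_ to _≟F_)
open import Data.Fin.Properties using (pigeonhole; toℕ<n; toℕ-fromℕ<; toℕ≤pred[n])
import Data.Fin.Properties as Finₚ
open import Data.Bool using (if_then_else_)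
open import Data.Sum using (inj₁; inj₂)
open import Data.Maybe using (just; nothing)
open import Data.Product using (∃; _×_; _,_; proj₁; proj₂)
open import Data.List using (List; []; _∷_; _++_; foldl; map; length)
open import Data.List.Properties using (length-map)
open import Data.List.Relation.Unary.All using (All; all?)
import Data.List.Relation.Unary.All as All
import Data.List.Relation.Unary.All.Properties as All
open import Data.List.Relation.Unary.Any using (Any; any?; here; there)
import Data.List.Relation.Unary.Any as Any
import Data.List.Relation.Unary.Any.Properties as Any
open import Data.List.Relation.Unary.AllPairs using (AllPairs; allPairs?)
import Data.List.Relation.Unary.AllPairs as AllPairs
import Data.List.Relation.Unary.AllPairs.Properties as AllPairs
open import Data.Vec using (lookup)
open import Function using (_∘_; _⇔_; mk⇔)
open import Function.Bundles using (module Equivalence)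
open import Function.Definitions using (Injective)
open import Relation.Binary.Definitions using (Decidable)
open import Relation.Binary.PropositionalEquality
  using (refl; sym; trans; cong; subst; _≢_; module ≡-Reasoning)
open import Relation.Binary.Construct.Closure.ReflexiveTransitive using (Star; ε; _◅_; _◅◅_)
open import Relation.Nullary using (¬_; Dec; yes; no; does; ¬?; _×-dec_; contradiction)
open import Relation.Nullary.Decidable using (map′; toWitness)

Reach : {A : Set} → (A → A) → A → A → Set
Reach f = Star (λ x y → y ≡ f x)

module _ {A : Set} (f : A → A) where

  iter-+ : ∀ m k x → iter f (m + k) x ≡ iter f m (iter f k x)
  iter-+ zero k x = refl
  iter-+ (suc m) k x = cong f (iter-+ m k x)

  reach-iter : ∀ j x → Reach f x (iter f j x)
  reach-iter zero x = ε
  reach-iter (suc j) x = reach-iter j x ◅◅ (refl ◅ ε)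

  reach⇒iter : ∀ {x y} → Reach f x y → ∃ λ j → iter f j x ≡ y
  reach⇒iter ε = 0 , refl
  reach⇒iter {x} (refl ◅ path) with reach⇒iter path
  ... | j , eq = j + 1 , trans (iter-+ j 1 x) eq

module _ {n : ℕ} (r : Fin n → Fin n) where

  iter-n-recurs : ∀ x → ∃ λ (j : Fin n) → iter r (toℕ j) x ≡ iter r n x
  iter-n-recurs x with pigeonhole (n<1+n n) (λ k → iter r (toℕ k) x)
  ... | i , j , i<j , eq = fromℕ< shortcut< , (begin
      iter r (toℕ (fromℕ< shortcut<)) x ≡⟨ cong (λ m → iter r m x) (toℕ-fromℕ< shortcut<) ⟩
      iter r (t + toℕ i) x              ≡⟨ iter-+ r t (toℕ i) x ⟩
      iter r t (iter r (toℕ i) x)       ≡⟨ cong (iter r t) eq ⟩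
      iter r t (iter r (toℕ j) x)       ≡⟨ iter-+ r t (toℕ j) x ⟨
      iter r (t + toℕ j) x              ≡⟨ cong (λ m → iter r m x) (m∸n+n≡m (toℕ≤pred[n] j)) ⟩
      iter r n x                        ∎)
    where
    open ≡-Reasoning
    t = n ∸ toℕ j
    shortcut< : t + toℕ i < n
    shortcut< = subst (t + toℕ i <_) (m∸n+n≡m (toℕ≤pred[n] j)) (+-monoʳ-< t i<j)

  iter-bounded : ∀ x j → ∃ λ (j' : Fin n) → iter r (toℕ j') x ≡ iter r j x
  iter-bounded Fin.zero zero = Fin.zero , refl
  iter-bounded (Fin.suc _) zero = Fin.zero , refl
  iter-bounded x (suc j) with iter-bounded x j
  ... | j' , eq with m≤n⇒m<n∨m≡n (toℕ<n j')
  ...   | inj₁ lt = fromℕ< lt , trans (cong (λ m → iter r m x) (toℕ-fromℕ< lt)) (cong r eq)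
  ...   | inj₂ last with iter-n-recurs x
  ...     | k , eqk = k , trans eqk (trans (cong (λ m → iter r m x) (sym last)) (cong r eq))

  reach? : Decidable (Reach r)
  reach? x y = map′ bounded⇒reach reach⇒bounded (Finₚ.any? (λ j → iter r (toℕ j) x ≟F y))
    where
    bounded⇒reach : (∃ λ j → iter r (toℕ j) x ≡ y) → Reach r x y
    bounded⇒reach (j , eq) = subst (Reach r x) eq (reach-iter r (toℕ j) x)
    reach⇒bounded : Reach r x y → ∃ λ j → iter r (toℕ j) x ≡ y
    reach⇒bounded path with reach⇒iter r path
    ... | j , eq with iter-bounded x j
    ...   | j' , eq' = j' , trans eq' eq

AreRepresentatives : {A : Set} → (A → A → Set) → List A → List A → ℕ → Set
AreRepresentatives R xs ys k = length ys ≡ k × AllPairs (λ y y' → ¬ R y y') ys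
                             × All (λ y → Any (R y) xs) ys × All (λ x → Any (R x) ys) xs

module _ {A : Set} {R : A → A → Set} (R? : Decidable R) where

  representatives : List A → List A
  representatives = foldl add []
    where
    add : List A → A → List A
    add ys x = if does (any? (R? x) ys) then ys else ys ++ x ∷ []

  areRepresentatives? : ∀ xs ys k → Dec (AreRepresentatives R xs ys k)
  areRepresentatives? xs ys k =
    (length ys ≟ℕ k) ×-dec allPairs? (λ y y' → ¬? (R? y y')) ys
    ×-dec all? (λ y → any? (R? y) xs) ys ×-dec all? (λ x → any? (R? x) ys) xs

numClasses-map : {A B : Set} {Q : A → A → Set} {R : B → B → Set} (f : A → B) →
  (∀ {x y} → Q x y ⇔ R (f x) (f y)) →
  ∀ {xs k} → NumClasses Q xs k → NumClasses R (map f xs) k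
numClasses-map {Q = Q} {R} f Q⇔R (ys , len , apart , reps-occur , covered) =
  map f ys , trans (length-map f ys) len ,
  AllPairs.map⁺ (AllPairs.map (λ ¬q → ¬q ∘ Equivalence.from Q⇔R) apart) ,
  All.map⁺ (All.map transport reps-occur) , All.map⁺ (All.map transport covered)
  where
  transport : ∀ {x zs} → Any (Q x) zs → Any (R (f x)) (map f zs)
  transport = Any.map⁺ ∘ Any.map (Equivalence.to Q⇔R)

module FirstReturn {A : Set} (ρ : A → A) {k : ℕ} (p : Fin k → A) where

  record Passage (x y : A) : Set where
    field
      steps    : ℕ
      nonempty : 0 < steps
      arrives  : iter ρ steps x ≡ y
      avoids   : ∀ i → 0 < i → i < steps → ∀ d → iter ρ i x ≢ p d

  open Passage

  module _ (p-injective : Injective _≡_ _≡_ p) (r : Fin k → Fin k)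
           (passage : ∀ d → Passage (p d) (p (r d))) where

    reach-lift : ∀ {d d'} → Reach r d d' → Reach ρ (p d) (p d')
    reach-lift ε = ε
    reach-lift {d} (refl ◅ path) =
      subst (Reach ρ (p d)) (arrives (passage d)) (reach-iter ρ (steps (passage d)) (p d))
      ◅◅ reach-lift path

    record Along (e : Fin k) (z : A) : Set where
      constructor along
      field
        start   : Fin k
        reached : Reach r e start
        offset  : ℕ
        inside  : offset < steps (passage start)
        at      : z ≡ iter ρ offset (p start)

    along-step : ∀ {e z} → Along e z → Along e (ρ z)
    along-step (along d e⇝d i i<steps at) with m≤n⇒m<n∨m≡n i<steps
    ... | inj₁ lt = along d e⇝d (suc i) lt (cong ρ at)
    ... | inj₂ eq = along (r d) (e⇝d ◅◅ (refl ◅ ε)) 0 (nonempty (passage (r d)))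
                          (trans (cong ρ at) (trans (cong (λ m → iter ρ m (p d)) eq) (arrives (passage d))))

    along-reach : ∀ {e z z'} → Along e z → Reach ρ z z' → Along e z'
    along-reach a ε = a
    along-reach a (refl ◅ path) = along-reach (along-step a) path

    along-end : ∀ {e d'} → Along e (p d') → Reach r e d'
    along-end (along d e⇝d zero _ at) = subst (Reach r _) (p-injective (sym at)) e⇝d
    along-end {d' = d'} (along d _ (suc i) i<steps at) =
      contradiction (sym at) (avoids (passage d) (suc i) (s≤s z≤n) i<steps d')

    reach-lower : ∀ {e e'} → Reach ρ (p e) (p e') → Reach r e e'
    reach-lower {e} path = along-end (along-reach (along e ε 0 (nonempty (passage e)) refl) path)

    reach-first-return : ∀ {d d'} → Reach r d d' ⇔ Reach ρ (p d) (p d')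
    reach-first-return = mk⇔ reach-lift reach-lower

swapSign : Fin 4 → Fin 4
swapSign Fin.zero = d3
swapSign (Fin.suc Fin.zero) = d4
swapSign (Fin.suc (Fin.suc Fin.zero)) = d1
swapSign (Fin.suc (Fin.suc (Fin.suc Fin.zero))) = d2

returnMap : Perm4 → Fin 4 → Fin 4
returnMap π = lookup π ∘ swapSign

-- e₁⁺, e₁⁻, e₂⁺, e₂⁻: the order in which ZigzagsThrough lists the flags of P.
flagsOfP : List (Fin 4)
flagsOfP = d1 ∷ d3 ∷ d2 ∷ d4 ∷ []

module Monodromy (Γ : Map) (τ : ZOrientation Γ) (P : SpecialPair Γ τ) where
  open Map Γ
  open SpecialPair P
  open NP Γ τ P

  flag : Fin 4 → Fin n
  flag = old ∘ label

  open FirstReturn (ρ Γ) flag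

  label∈allNew : ∀ d → label d ∈ allNew
  label∈allNew Fin.zero = here refl
  label∈allNew (Fin.suc Fin.zero) = there (there (here refl))
  label∈allNew (Fin.suc (Fin.suc Fin.zero)) = there (there (there (there (here refl))))
  label∈allNew (Fin.suc (Fin.suc (Fin.suc Fin.zero))) = there (there (there (there (there (there (here refl))))))

  matchOld-inj₁ : ∀ x νs {y} → matchOld x νs ≡ inj₁ y → y ≡ σ₂ x × All (λ ν → x ≢ old ν) νs
  matchOld-inj₁ x [] refl = refl , All.[]
  matchOld-inj₁ x (ν ∷ νs) eq with x ≟F old ν
  ... | no x≢ν with matchOld-inj₁ x νs eq
  ...   | y≡ , rest = y≡ , x≢ν All.∷ rest

  matchOld-inj₂ : ∀ x νs {μ} → matchOld x νs ≡ inj₂ μ → x ≡ old μ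
  matchOld-inj₂ x (ν ∷ νs) eq with x ≟F old ν
  matchOld-inj₂ x (ν ∷ νs) refl | yes x≡ν = x≡ν
  ... | no _ = matchOld-inj₂ x νs eq

  off-F_P : ∀ x → dirEdge (inj₁ x) ≡ nothing →
            σ₂N (inj₁ x) ≡ inj₁ (σ₂ x) × All (λ ν → x ≢ old ν) allNew
  off-F_P x h with matchOld x allNew in eq
  ... | inj₁ y with matchOld-inj₁ x allNew eq
  ...   | y≡ , unmatched = cong inj₁ y≡ , unmatched

  reentry-flag : ∀ {w x μ} → w ≡ inj₁ x → dirEdge w ≡ just μ → x ≡ old μ
  reentry-flag {x = x} refl h with matchOld x allNew in eq
  reentry-flag {x = x} refl refl | inj₂ ν = matchOld-inj₂ x allNew eq

  ρN-off-F_P : ∀ {w x} → w ≡ inj₁ x → dirEdge w ≡ nothing → ρN w ≡ inj₁ (ρ Γ x)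
  ρN-off-F_P refl h = cong (σ₁N ∘ σ₀N) (proj₁ (off-F_P _ h))

  unmarked-off-F_P : ∀ {w x} → w ≡ inj₁ x → dirEdge w ≡ nothing → ∀ d → x ≢ flag d
  unmarked-off-F_P refl h d = All.lookup (proj₂ (off-F_P _ h)) (label∈allNew d)

  zigzag-leaving-F_P : ∀ ν j → (∀ i → 0 < i → i < j → dirEdge (iter ρN i (inj₂ ν)) ≡ nothing) →
                       ∀ i → 0 < i → i ≤ j → iter ρN i (inj₂ ν) ≡ inj₁ (iter (ρ Γ) i (σ₂ (old ν)))
  zigzag-leaving-F_P ν j off (suc zero) _ _ = cong (λ z → inj₁ (σ₁ (σ₀ z))) (sym (σ₂-inv (old ν)))
  zigzag-leaving-F_P ν j off (suc (suc i)) _ i<j =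
    ρN-off-F_P (zigzag-leaving-F_P ν j off (suc i) (s≤s z≤n) (<⇒≤ i<j)) (off (suc i) (s≤s z≤n) i<j)

  monodromy⇒passage : ∀ {ν μ} → Mono ν μ → Passage (σ₂ (old ν)) (old μ)
  monodromy⇒passage {ν} (j , 0<j , hit , off) = record
    { steps = j
    ; nonempty = 0<j
    ; arrives = reentry-flag (zigzag-leaving-F_P ν j off j 0<j ≤-refl) hit
    ; avoids = λ i 0<i i<j → unmarked-off-F_P (zigzag-leaving-F_P ν j off i 0<i (<⇒≤ i<j)) (off i 0<i i<j)
    }

  flag-swapSign : ∀ d → σ₂ (flag (swapSign d)) ≡ flag d
  flag-swapSign Fin.zero = trans (sym (σ₀σ₂-comm (σ₂ a))) (cong σ₀ (σ₂-inv a))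
  flag-swapSign (Fin.suc Fin.zero) = σ₂-inv b
  flag-swapSign (Fin.suc (Fin.suc Fin.zero)) = sym (σ₀σ₂-comm a)
  flag-swapSign (Fin.suc (Fin.suc (Fin.suc Fin.zero))) = refl

  off-e₂ : ∀ {x} → SameEdge Γ a x → x ≢ b × x ≢ σ₂ b
  off-e₂ a⇝x = (λ x≡b → distinct-edges (subst (SameEdge Γ a) x≡b a⇝x))
             , (λ x≡σ₂b → distinct-edges (subst (SameEdge Γ a) (trans (cong σ₂ x≡σ₂b) (σ₂-inv b))
                                                                (a⇝x ◅◅ (inj₂ refl ◅ ε))))

  σ₀a-off-e₂ : σ₀ a ≢ b × σ₀ a ≢ σ₂ b
  σ₀a-off-e₂ = off-e₂ (inj₁ refl ◅ ε)

  σ₀σ₂a-off-e₂ : σ₀ (σ₂ a) ≢ b × σ₀ (σ₂ a) ≢ σ₂ b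
  σ₀σ₂a-off-e₂ = off-e₂ (inj₂ refl ◅ inj₁ refl ◅ ε)

  σ₀a≢σ₀σ₂a : σ₀ a ≢ σ₀ (σ₂ a)
  σ₀a≢σ₀σ₂a eq = σ₂-free a (sym (trans (sym (σ₀-inv a)) (trans (cong σ₀ eq) (σ₀-inv (σ₂ a)))))

  flag-injective : Injective _≡_ _≡_ flag
  flag-injective {Fin.zero} {Fin.zero} _ = refl
  flag-injective {Fin.zero} {Fin.suc Fin.zero} eq = contradiction eq (proj₁ σ₀a-off-e₂)
  flag-injective {Fin.zero} {Fin.suc (Fin.suc Fin.zero)} eq = contradiction eq σ₀a≢σ₀σ₂a
  flag-injective {Fin.zero} {Fin.suc (Fin.suc (Fin.suc Fin.zero))} eq = contradiction eq (proj₂ σ₀a-off-e₂)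
  flag-injective {Fin.suc Fin.zero} {Fin.zero} eq = contradiction (sym eq) (proj₁ σ₀a-off-e₂)
  flag-injective {Fin.suc Fin.zero} {Fin.suc Fin.zero} _ = refl
  flag-injective {Fin.suc Fin.zero} {Fin.suc (Fin.suc Fin.zero)} eq = contradiction (sym eq) (proj₁ σ₀σ₂a-off-e₂)
  flag-injective {Fin.suc Fin.zero} {Fin.suc (Fin.suc (Fin.suc Fin.zero))} eq = contradiction (sym eq) (σ₂-free b)
  flag-injective {Fin.suc (Fin.suc Fin.zero)} {Fin.zero} eq = contradiction (sym eq) σ₀a≢σ₀σ₂a
  flag-injective {Fin.suc (Fin.suc Fin.zero)} {Fin.suc Fin.zero} eq = contradiction eq (proj₁ σ₀σ₂a-off-e₂)
  flag-injective {Fin.suc (Fin.suc Fin.zero)} {Fin.suc (Fin.suc Fin.zero)} _ = refl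
  flag-injective {Fin.suc (Fin.suc Fin.zero)} {Fin.suc (Fin.suc (Fin.suc Fin.zero))} eq = contradiction eq (proj₂ σ₀σ₂a-off-e₂)
  flag-injective {Fin.suc (Fin.suc (Fin.suc Fin.zero))} {Fin.zero} eq = contradiction (sym eq) (proj₂ σ₀a-off-e₂)
  flag-injective {Fin.suc (Fin.suc (Fin.suc Fin.zero))} {Fin.suc Fin.zero} eq = contradiction eq (σ₂-free b)
  flag-injective {Fin.suc (Fin.suc (Fin.suc Fin.zero))} {Fin.suc (Fin.suc Fin.zero)} eq = contradiction (sym eq) (proj₂ σ₀σ₂a-off-e₂)
  flag-injective {Fin.suc (Fin.suc (Fin.suc Fin.zero))} {Fin.suc (Fin.suc (Fin.suc Fin.zero))} _ = refl

  module _ {π : Perm4} (monodromy : MonodromyIs Γ τ P π) where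

    passage : ∀ d → Passage (flag d) (flag (returnMap π d))
    passage d = subst (λ x → Passage x (flag (returnMap π d))) (flag-swapSign d)
                      (monodromy⇒passage (monodromy (swapSign d)))

    zigzags-through-P : ∀ {k} → NumClasses (Reach (returnMap π)) flagsOfP k →
                        ZigzagsThrough Γ τ P k
    zigzags-through-P {k} classes =
      subst (λ xs → NumClasses (SameZigzag Γ) xs k) (cong (λ x → σ₀ a ∷ x ∷ b ∷ σ₂ b ∷ []) (σ₀σ₂-comm a))
            (numClasses-map flag (reach-first-return flag-injective (returnMap π) passage) classes)

-- The greedy candidates are verified by evaluation, for every π in every class.
cycle-counts : ∀ i → All (λ π → NumClasses (Reach (returnMap π)) flagsOfP (kOf i)) (K i)
cycle-counts i = All.map (_ ,_) (toWitness {a? = Finₚ.all? verify} _ i)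
  where
  candidates : Perm4 → List (Fin 4)
  candidates π = representatives (reach? (returnMap π)) flagsOfP
  verify : ∀ i → Dec (All (λ π → AreRepresentatives (Reach (returnMap π)) flagsOfP (candidates π) (kOf i)) (K i))
  verify i = all? (λ π → areRepresentatives? (reach? (returnMap π)) flagsOfP (candidates π) (kOf i)) (K i)

lemma3 : (Γ : Map) (τ : ZOrientation Γ) → Triangulation Γ → ZHomogeneous Γ τ →
         (P : SpecialPair Γ τ) (i : Fin 13) (π : Perm4) → π ∈ K i →
         MonodromyIs Γ τ P π → ZigzagsThrough Γ τ P (kOf i)
lemma3 Γ τ _ _ P i π π∈Kᵢ monodromy =
  Monodromy.zigzags-through-P Γ τ P {π} monodromy (All.lookup (cycle-counts i) π∈Kᵢ)
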